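{- Let $A=[a_1,\ldots,a_n]$ be a $1\times n$ matrix with positive integer entries, and let $\mathcal{L}=\ker(A)\cap\mathbf{Z}^n$. For $b\in\mathbf{N}$ let $f(b)$ be the number of vertices of the polytope $P_b=\mathrm{conv}\{u\in\mathbf{N}^n : Au=b\}$ (with $f(b)=0$ if this set is empty). Then $f$ is eventually periodic with period dividing $\mathrm{lcm}_i(a_i)$, i.e. there is $N$ such that $f(b+\mathrm{lcm}_i(a_i))=f(b)$ for all $b\ge N$.
   Context: For $u\in\mathbf{N}^n$, the fiber of $u$ with respect to $\mathcal{L}$ is $\mathrm{conv}\{v\in\mathbf{N}^n: u-v\in\mathcal{L}\}$, which here equals $P_{Au}$. -}

module Defs where

open import Data.Nat using (ℕ; zero; suc; _+_; _*_; NonZero)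
open import Data.Nat.LCM using (lcm)
open import Data.Fin using (Fin; zero; suc)
open import Data.Vec using (Vec; lookup)
open import Data.List using (List; []; _∷_; map; length)
open import Data.List.Relation.Unary.All using (All)
open import Data.List.Relation.Unary.Unique.Propositional using (Unique)
open import Data.List.Membership.Propositional using (_∈_)
open import Data.Product using (_×_; _,_; ∃; Σ)
open import Data.Integer using (+_)
import Data.Rational as Q
open Q using (ℚ)
open import Relation.Binary.PropositionalEquality using (_≡_)
open import Relation.Nullary using (¬_)

-- A 1×n matrix A = [a_1,…,a_n] is a function Fin n → ℕ.
-- Lattice points of ℕ^n are vectors Vec ℕ n.

sumFin : ∀ {n} → (Fin n → ℕ) → ℕ
sumFin {zero} f = 0
sumFin {suc n} f = f zero + sumFin (λ i → f (suc i))

_·_ : ∀ {n} → (Fin n → ℕ) → Vec ℕ n → ℕ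
A · u = sumFin (λ i → A i * lookup u i)

lcmAll : ∀ {n} → (Fin n → ℕ) → ℕ
lcmAll {zero} A = 1
lcmAll {suc n} A = lcm (A zero) (lcmAll (λ i → A (suc i)))

ℕ→ℚ : ℕ → ℚ
ℕ→ℚ k = (+ k) Q./ 1

sumℚ : List ℚ → ℚ
sumℚ [] = Q.0ℚ
sumℚ (x ∷ xs) = x Q.+ sumℚ xs

IsConvComb : ∀ {n} → List (ℚ × Vec ℕ n) → Vec ℕ n → Set
IsConvComb cs u =
  All (λ p → Q.0ℚ Q.≤ Data.Product.proj₁ p) cs
  × sumℚ (map Data.Product.proj₁ cs) ≡ Q.1ℚ
  × (∀ i → sumℚ (map (λ p → Data.Product.proj₁ p Q.* ℕ→ℚ (lookup (Data.Product.proj₂ p) i)) cs)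
           ≡ ℕ→ℚ (lookup u i))

-- u is a vertex of P_b = conv{v ∈ ℕ^n : A v = b}:
-- u lies in the fiber and is not a convex combination of other points of the fiber.
IsVertex : ∀ {n} → (Fin n → ℕ) → ℕ → Vec ℕ n → Set
IsVertex {n} A b u =
  A · u ≡ b ×
  ¬ (Σ (List (ℚ × Vec ℕ n)) λ cs →
       All (λ p → A · Data.Product.proj₂ p ≡ b × ¬ (Data.Product.proj₂ p ≡ u)) cs
       × IsConvComb cs u)

-- f(b) = k : the polytope P_b has exactly k vertices
-- (0 when the fiber is empty, since then no point is a vertex)
VertexCount : ∀ {n} → (Fin n → ℕ) → ℕ → ℕ → Set
VertexCount {n} A b k =
  Σ (List (Vec ℕ n)) λ L →
    Unique L × length L ≡ k
    × (∀ u → (u ∈ L → IsVertex A b u) × (IsVertex A b u → u ∈ L))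

-- Call a coordinate of u ∈ ℕⁿ small when it is below M = 1 + Σ aᵢ. If two coordinates i ≠ j of
-- a fibre point u are not small, then u is the midpoint of the two fibre points obtained by
-- trading aⱼ units of coordinate i for aᵢ units of coordinate j and back, so u is no vertex; and
-- if all coordinates are small then A u is small. Hence for b ≥ N₀ every vertex u of P_b has a
-- single large coordinate i, and raising it by dᵢ = lcm / aᵢ maps u into the fibre over b + lcm.
-- This map is a bijection between the vertices of P_b and of P_{b+lcm}. A nontrivial relation
-- Σ λ_v (v − u) = 0 with λ ≥ 0 and v ≠ u in the fibre over b, which is what it means for u not
-- to be a vertex, is carried along by the shift. Conversely, for v in the fibre over b + lcm,
-- the difference v − (u + dᵢeᵢ) is a sum of differences w − u with w in the fibre over b: trade
-- from a large coordinate k of v into coordinate i, which records the step (u + aᵢeₖ − aₖeᵢ) − u,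
-- until coordinate i reaches dᵢ and dᵢeᵢ can be removed. Being a vertex is decided by
-- Fourier–Motzkin elimination on these differences, so each P_b has a computable list of vertices.

{-# OPTIONS --safe #-}
module Submission where

open import Defs
open import Data.Nat as ℕ using (ℕ; zero; suc; NonZero)
import Data.Nat.Properties as ℕ
open import Data.Nat.Divisibility using (_∣_; ∣-trans)
open import Data.Nat.LCM using (m∣lcm[m,n]; n∣lcm[m,n])
open import Data.Rational as ℚ using (ℚ; 0ℚ; 1ℚ)
import Data.Rational.Properties as ℚ
open import Data.Fin as Fin using (Fin; zero; suc)
import Data.Fin.Properties as Fin
open import Data.Vec as Vec using (Vec; []; _∷_; lookup)
import Data.Vec.Properties as Vec
open import Data.List as List using (List; []; _∷_; _++_; map; concatMap; filter; length; cartesianProductWith)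
import Data.List.Properties as List
open import Data.List.Relation.Unary.All as All using (All; []; _∷_)
import Data.List.Relation.Unary.All.Properties as All
open import Data.List.Relation.Unary.Any as Any using (Any; here; there)
import Data.List.Relation.Unary.Any.Properties as Any
open import Data.List.Relation.Unary.AllPairs using ([]; _∷_)
open import Data.List.Relation.Unary.Unique.Propositional using (Unique)
import Data.List.Relation.Unary.Unique.Propositional.Properties as Unique
open import Data.List.Membership.Propositional using (_∈_)
import Data.List.Membership.Propositional.Properties as ∈
open import Data.List.Relation.Binary.Permutation.Propositional as ↭ using (_↭_)
import Data.List.Relation.Binary.Permutation.Propositional.Properties as ↭
open import Data.Product using (Σ; ∃; _×_; _,_; proj₁; proj₂; map₁; map₂)
open import Data.Sum as Sum using (_⊎_; inj₁; inj₂)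
open import Data.Empty using (⊥-elim)
open import Function using (_∘_; id)
open import Relation.Binary using (tri<; tri≈; tri>)
open import Relation.Binary.PropositionalEquality
  using (_≡_; _≢_; refl; sym; trans; cong; cong₂; subst; module ≡-Reasoning)
open import Relation.Nullary using (¬_; Dec; yes; no; ¬?; _×-dec_)

module WeightedSums where
  open import Data.Rational using (_+_; _*_; -_; _≤_; _<_)
  open import Data.Rational.Solver using (module +-*-Solver)
  open +-*-Solver using (solve; _:+_; _:*_; :-_; _:=_)

  0<1 : 0ℚ < 1ℚ
  0<1 = ℚ.positive⁻¹ 1ℚ

  0≤* : ∀ {p q} → 0ℚ ≤ p → 0ℚ ≤ q → 0ℚ ≤ p * q
  0≤* {p} {q} 0≤p 0≤q =
    ℚ.nonNegative⁻¹ _ {{ℚ.nonNeg*nonNeg⇒nonNeg p {{ℚ.nonNegative 0≤p}} q {{ℚ.nonNegative 0≤q}}}}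

  0<* : ∀ {p q} → 0ℚ < p → 0ℚ < q → 0ℚ < p * q
  0<* {p} {q} 0<p 0<q = ℚ.positive⁻¹ _ {{ℚ.pos*pos⇒pos p {{ℚ.positive 0<p}} q {{ℚ.positive 0<q}}}}

  ≡0-cancelʳ : ∀ {p q} → 0ℚ < q → p * q ≡ 0ℚ → p ≡ 0ℚ
  ≡0-cancelʳ {p} {q} 0<q pq≡0 = begin
    p                ≡⟨ sym (ℚ.*-identityʳ p) ⟩
    p * 1ℚ           ≡⟨ cong (p *_) (sym (ℚ.*-inverseʳ q)) ⟩
    p * (q * ℚ.1/ q) ≡⟨ sym (ℚ.*-assoc p q _) ⟩
    p * q * ℚ.1/ q   ≡⟨ cong (_* ℚ.1/ q) pq≡0 ⟩
    0ℚ * ℚ.1/ q      ≡⟨ ℚ.*-zeroˡ (ℚ.1/ q) ⟩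
    0ℚ               ∎
    where
    open ≡-Reasoning
    instance
      q≢0 : ℚ.NonZero q
      q≢0 = ℚ.pos⇒nonZero q {{ℚ.positive 0<q}}

  +≡0⇒≡0ˡ : ∀ {p q} → 0ℚ ≤ p → 0ℚ ≤ q → p + q ≡ 0ℚ → p ≡ 0ℚ
  +≡0⇒≡0ˡ {p} {q} 0≤p 0≤q p+q≡0 = ℚ.≤-antisym p≤0 0≤p
    where
    p≤0 : p ≤ 0ℚ
    p≤0 = begin
      p       ≡⟨ ℚ.+-identityʳ p ⟨
      p + 0ℚ  ≤⟨ ℚ.+-monoʳ-≤ p 0≤q ⟩
      p + q   ≡⟨ p+q≡0 ⟩
      0ℚ      ∎
      where open ℚ.≤-Reasoning

  wsum : {X : Set} → (X → ℚ) → List (ℚ × X) → ℚ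
  wsum f cs = sumℚ (map (λ p → proj₁ p * f (proj₂ p)) cs)

  module _ {X : Set} where

    wsum-++ : ∀ (f : X → ℚ) cs ds → wsum f (cs ++ ds) ≡ wsum f cs + wsum f ds
    wsum-++ f [] ds = sym (ℚ.+-identityˡ _)
    wsum-++ f ((c , x) ∷ cs) ds =
      trans (cong (c * f x +_) (wsum-++ f cs ds)) (sym (ℚ.+-assoc (c * f x) _ _))

    wsum-↭ : ∀ (f : X → ℚ) {cs ds} → cs ↭ ds → wsum f cs ≡ wsum f ds
    wsum-↭ f ↭.refl = refl
    wsum-↭ f (↭.prep (c , x) σ) = cong (c * f x +_) (wsum-↭ f σ)
    wsum-↭ f (↭.swap {xs = cs} {ys = ds} (c , x) (d , y) σ) = begin
      c * f x + (d * f y + wsum f cs) ≡⟨ ℚ.+-assoc (c * f x) _ _ ⟨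
      c * f x + d * f y + wsum f cs   ≡⟨ cong₂ _+_ (ℚ.+-comm (c * f x) (d * f y)) (wsum-↭ f σ) ⟩
      d * f y + c * f x + wsum f ds   ≡⟨ ℚ.+-assoc (d * f y) _ _ ⟩
      d * f y + (c * f x + wsum f ds) ∎
      where open ≡-Reasoning
    wsum-↭ f (↭.trans σ τ) = trans (wsum-↭ f σ) (wsum-↭ f τ)

    wsum-cong : ∀ {f g : X → ℚ} cs → (∀ x → f x ≡ g x) → wsum f cs ≡ wsum g cs
    wsum-cong [] f≗g = refl
    wsum-cong ((c , x) ∷ cs) f≗g = cong₂ (λ a b → c * a + b) (f≗g x) (wsum-cong cs f≗g)

    wsum-+ : ∀ (f g : X → ℚ) cs → wsum (λ x → f x + g x) cs ≡ wsum f cs + wsum g cs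
    wsum-+ f g [] = sym (ℚ.+-identityˡ 0ℚ)
    wsum-+ f g ((c , x) ∷ cs) = trans (cong (c * (f x + g x) +_) (wsum-+ f g cs))
      (solve 5 (λ c a b r s → c :* (a :+ b) :+ (r :+ s) := (c :* a :+ r) :+ (c :* b :+ s))
        refl c (f x) (g x) (wsum f cs) (wsum g cs))

    wsum-*ˡ : ∀ a (f : X → ℚ) cs → wsum (λ x → a * f x) cs ≡ a * wsum f cs
    wsum-*ˡ a f [] = sym (ℚ.*-zeroʳ a)
    wsum-*ˡ a f ((c , x) ∷ cs) = trans (cong (c * (a * f x) +_) (wsum-*ˡ a f cs))
      (solve 4 (λ c a b r → c :* (a :* b) :+ a :* r := a :* (c :* b :+ r)) refl c a (f x) (wsum f cs))

    wsum-neg : ∀ (f : X → ℚ) cs → wsum (λ x → - f x) cs ≡ - wsum f cs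
    wsum-neg f [] = refl
    wsum-neg f ((c , x) ∷ cs) = trans (cong (c * (- f x) +_) (wsum-neg f cs))
      (solve 3 (λ c b r → c :* (:- b) :+ (:- r) := :- (c :* b :+ r)) refl c (f x) (wsum f cs))

    wsum-const : ∀ a (cs : List (ℚ × X)) → wsum (λ _ → a) cs ≡ sumℚ (map proj₁ cs) * a
    wsum-const a [] = sym (ℚ.*-zeroˡ a)
    wsum-const a ((c , x) ∷ cs) =
      trans (cong (c * a +_) (wsum-const a cs)) (sym (ℚ.*-distribʳ-+ a c _))

    totalWeight-scale : ∀ a (cs : List (ℚ × X)) →
                        sumℚ (map proj₁ (map (map₁ (a *_)) cs)) ≡ a * sumℚ (map proj₁ cs)
    totalWeight-scale a [] = sym (ℚ.*-zeroʳ a)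
    totalWeight-scale a ((c , x) ∷ cs) =
      trans (cong (a * c +_) (totalWeight-scale a cs)) (sym (ℚ.*-distribˡ-+ a c _))

    totalWeight-nonneg : ∀ {cs : List (ℚ × X)} → All ((0ℚ ≤_) ∘ proj₁) cs →
                         0ℚ ≤ sumℚ (map proj₁ cs)
    totalWeight-nonneg [] = ℚ.≤-refl
    totalWeight-nonneg (0≤c ∷ 0≤cs) = ℚ.+-mono-≤ 0≤c (totalWeight-nonneg 0≤cs)

    0<totalWeight : ∀ {cs : List (ℚ × X)} → All ((0ℚ ≤_) ∘ proj₁) cs → Any ((0ℚ <_) ∘ proj₁) cs →
                    0ℚ < sumℚ (map proj₁ cs)
    0<totalWeight (_ ∷ 0≤cs) (here 0<c) = ℚ.+-mono-<-≤ 0<c (totalWeight-nonneg 0≤cs)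
    0<totalWeight (0≤c ∷ 0≤cs) (there pos) = ℚ.+-mono-≤-< 0≤c (0<totalWeight 0≤cs pos)

    wsum-scale : ∀ a (f : X → ℚ) cs → wsum f (map (map₁ (a *_)) cs) ≡ a * wsum f cs
    wsum-scale a f [] = sym (ℚ.*-zeroʳ a)
    wsum-scale a f ((c , x) ∷ cs) = trans (cong (a * c * f x +_) (wsum-scale a f cs))
      (solve 4 (λ a c b r → a :* c :* b :+ a :* r := a :* (c :* b :+ r)) refl a c (f x) (wsum f cs))

    wsum-zeroWeights : ∀ (f : X → ℚ) {cs} → All ((_≡ 0ℚ) ∘ proj₁) cs → wsum f cs ≡ 0ℚ
    wsum-zeroWeights f [] = refl
    wsum-zeroWeights f {(_ , x) ∷ _} (refl ∷ zs) =
      trans (cong₂ _+_ (ℚ.*-zeroˡ (f x)) (wsum-zeroWeights f zs)) (ℚ.+-identityʳ 0ℚ)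

    wsum-zeroValues : ∀ (f : X → ℚ) {cs} → All ((_≡ 0ℚ) ∘ f ∘ proj₂) cs → wsum f cs ≡ 0ℚ
    wsum-zeroValues f [] = refl
    wsum-zeroValues f {(c , _) ∷ _} (fx≡0 ∷ zs) =
      trans (cong₂ (λ a b → c * a + b) fx≡0 (wsum-zeroValues f zs))
        (trans (cong (_+ 0ℚ) (ℚ.*-zeroʳ c)) (ℚ.+-identityʳ 0ℚ))

    wsum-nonneg : ∀ (f : X → ℚ) {cs} → All ((0ℚ ≤_) ∘ proj₁) cs →
                  All ((0ℚ ≤_) ∘ f ∘ proj₂) cs → 0ℚ ≤ wsum f cs
    wsum-nonneg f [] [] = ℚ.≤-refl
    wsum-nonneg f (0≤c ∷ 0≤cs) (0≤fx ∷ 0≤fs) = ℚ.+-mono-≤ (0≤* 0≤c 0≤fx) (wsum-nonneg f 0≤cs 0≤fs)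

    wsum≡0⇒zeroWeights : ∀ (f : X → ℚ) {cs} → All ((0ℚ ≤_) ∘ proj₁) cs →
                         All ((0ℚ <_) ∘ f ∘ proj₂) cs → wsum f cs ≡ 0ℚ → All ((_≡ 0ℚ) ∘ proj₁) cs
    wsum≡0⇒zeroWeights f [] [] _ = []
    wsum≡0⇒zeroWeights f {(c , x) ∷ cs} (0≤c ∷ 0≤cs) (0<fx ∷ 0<fs) sum≡0 =
      ≡0-cancelʳ 0<fx (+≡0⇒≡0ˡ head≥0 rest≥0 sum≡0)
      ∷ wsum≡0⇒zeroWeights f 0≤cs 0<fs
          (+≡0⇒≡0ˡ rest≥0 head≥0 (trans (ℚ.+-comm (wsum f cs) (c * f x)) sum≡0))
      where
      head≥0 = 0≤* 0≤c (ℚ.<⇒≤ 0<fx)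
      rest≥0 = wsum-nonneg f 0≤cs (All.map ℚ.<⇒≤ 0<fs)

    wsum>0⇒positiveWeight : ∀ (f : X → ℚ) {cs} → All ((0ℚ ≤_) ∘ proj₁) cs →
                            0ℚ < wsum f cs → Any ((0ℚ <_) ∘ proj₁) cs
    wsum>0⇒positiveWeight f {[]} [] 0<0 = ⊥-elim (ℚ.<-irrefl refl 0<0)
    wsum>0⇒positiveWeight f {(c , x) ∷ cs} (0≤c ∷ 0≤cs) 0<sum with 0ℚ ℚ.<? c
    ... | yes 0<c = here 0<c
    ... | no 0≮c = there (wsum>0⇒positiveWeight f 0≤cs (subst (0ℚ <_) drop-head 0<sum))
      where
      drop-head : c * f x + wsum f cs ≡ wsum f cs
      drop-head = begin
        c * f x + wsum f cs  ≡⟨ cong (λ a → a * f x + wsum f cs) (ℚ.≤-antisym (ℚ.≮⇒≥ 0≮c) 0≤c) ⟩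
        0ℚ * f x + wsum f cs ≡⟨ cong (_+ wsum f cs) (ℚ.*-zeroˡ (f x)) ⟩
        0ℚ + wsum f cs       ≡⟨ ℚ.+-identityˡ _ ⟩
        wsum f cs            ∎
        where open ≡-Reasoning

  zeroWeights⇒¬positive : ∀ {X : Set} {cs : List (ℚ × X)} →
                          All ((_≡ 0ℚ) ∘ proj₁) cs → ¬ Any ((0ℚ <_) ∘ proj₁) cs
  zeroWeights⇒¬positive cs≡0 = All.All¬⇒¬Any (All.map (λ c≡0 0<c → ℚ.<-irrefl (sym c≡0) 0<c) cs≡0)

  wsum-map₂ : ∀ {X Y : Set} (f : Y → ℚ) (g : X → Y) cs → wsum f (map (map₂ g) cs) ≡ wsum (f ∘ g) cs
  wsum-map₂ f g [] = refl
  wsum-map₂ f g ((c , x) ∷ cs) = cong (c * f (g x) +_) (wsum-map₂ f g cs)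

  pairsWith : {X Y Z : Set} → (X → Y → Z) → List (ℚ × X) → List (ℚ × Y) → List (ℚ × Z)
  pairsWith g cs ds = concatMap (λ p → map (λ q → proj₁ p * proj₁ q , g (proj₂ p) (proj₂ q)) ds) cs

  module _ {X Y Z : Set} (g : X → Y → Z) where

    wsum-pairsWith : ∀ (f : Z → ℚ) cs ds →
                     wsum f (pairsWith g cs ds) ≡ wsum (λ x → wsum (λ y → f (g x y)) ds) cs
    wsum-pairsWith f [] ds = refl
    wsum-pairsWith f ((c , x) ∷ cs) ds = begin
      wsum f (row ++ pairsWith g cs ds)       ≡⟨ wsum-++ f row _ ⟩
      wsum f row + wsum f (pairsWith g cs ds) ≡⟨ cong₂ _+_ (wsum-row ds) (wsum-pairsWith f cs ds) ⟩
      c * wsum (λ y → f (g x y)) ds + wsum (λ x → wsum (λ y → f (g x y)) ds) cs ∎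
      where
      open ≡-Reasoning
      row = map (λ q → c * proj₁ q , g x (proj₂ q)) ds
      wsum-row : ∀ ds → wsum f (map (λ q → c * proj₁ q , g x (proj₂ q)) ds) ≡ c * wsum (λ y → f (g x y)) ds
      wsum-row [] = sym (ℚ.*-zeroʳ c)
      wsum-row ((d , y) ∷ ds) = trans (cong (c * d * f (g x y) +_) (wsum-row ds))
        (solve 4 (λ c d a r → c :* d :* a :+ c :* r := c :* (d :* a :+ r)) refl c d (f (g x y)) _)

    All-pairsWith : ∀ {P : ℚ × X → Set} {Q : ℚ × Y → Set} {R : ℚ × Z → Set} →
                    (∀ {p q} → P p → Q q → R (proj₁ p * proj₁ q , g (proj₂ p) (proj₂ q))) →
                    ∀ {cs ds} → All P cs → All Q ds → All R (pairsWith g cs ds)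
    All-pairsWith combine [] Qds = []
    All-pairsWith combine (Pp ∷ Pcs) Qds =
      All.++⁺ (All.map⁺ (All.map (combine Pp) Qds)) (All-pairsWith combine Pcs Qds)

    Any-pairsWith : ∀ {P : ℚ × X → Set} {Q : ℚ × Y → Set} {R : ℚ × Z → Set} →
                    (∀ {p q} → P p → Q q → R (proj₁ p * proj₁ q , g (proj₂ p) (proj₂ q))) →
                    ∀ {cs ds} → Any P cs → Any Q ds → Any R (pairsWith g cs ds)
    Any-pairsWith combine (here Pp) Qds = Any.++⁺ˡ (Any.map⁺ (Any.map (combine Pp) Qds))
    Any-pairsWith combine {_ ∷ _} {ds} (there Pcs) Qds =
      Any.++⁺ʳ (map _ ds) (Any-pairsWith combine Pcs Qds)

  record SignSplit {X : Set} (key : X → ℚ) (xs : List X) : Set where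
    constructor signSplit
    field
      zeros positives negatives : List X
      zeros≡0     : All ((_≡ 0ℚ) ∘ key) zeros
      positives>0 : All ((0ℚ <_) ∘ key) positives
      negatives<0 : All ((_< 0ℚ) ∘ key) negatives
      reorder     : xs ↭ zeros ++ positives ++ negatives

  splitBySign : {X : Set} (key : X → ℚ) (xs : List X) → SignSplit key xs
  splitBySign key [] = signSplit [] [] [] [] [] [] ↭.refl
  splitBySign key (x ∷ xs) with ℚ.<-cmp (key x) 0ℚ | splitBySign key xs
  ... | tri≈ _ k≡0 _ | signSplit Z P N Z≡0 P>0 N<0 σ =
    signSplit (x ∷ Z) P N (k≡0 ∷ Z≡0) P>0 N<0 (↭.prep x σ)
  ... | tri> _ _ k>0 | signSplit Z P N Z≡0 P>0 N<0 σ =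
    signSplit Z (x ∷ P) N Z≡0 (k>0 ∷ P>0) N<0 (↭.trans (↭.prep x σ) (↭.↭-sym (↭.shift x Z (P ++ N))))
  ... | tri< k<0 _ _ | signSplit Z P N Z≡0 P>0 N<0 σ =
    signSplit Z P (x ∷ N) Z≡0 P>0 (k<0 ∷ N<0)
      (↭.trans (↭.prep x σ) (↭.↭-sym (↭.trans (↭.++⁺ˡ Z (↭.shift x P N)) (↭.shift x Z (P ++ N)))))

  module _ {X : Set} {key : X → ℚ} {xs : List X} (s : SignSplit key xs) where
    open SignSplit s

    SignSplit-All : ∀ {Q : X → Set} → All Q xs → All Q zeros × All Q positives × All Q negatives
    SignSplit-All Qxs = map₂ (All.++⁻ positives) (All.++⁻ zeros (↭.All-resp-↭ reorder Qxs))

    SignSplit-Any : ∀ {Q : X → Set} → Any Q xs → Any Q zeros ⊎ Any Q positives ⊎ Any Q negatives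
    SignSplit-Any Qxs = Sum.map₂ (Any.++⁻ positives) (Any.++⁻ zeros (↭.Any-resp-↭ reorder Qxs))

  SignSplit-wsum : ∀ {X : Set} {key} {cs : List (ℚ × X)} (s : SignSplit key cs) (f : X → ℚ) →
                   let open SignSplit s in
                   wsum f cs ≡ wsum f zeros + (wsum f positives + wsum f negatives)
  SignSplit-wsum s f = trans (wsum-↭ f reorder)
    (trans (wsum-++ f zeros _) (cong (wsum f zeros +_) (wsum-++ f positives negatives)))
    where open SignSplit s

module ConicCombinations where
  open import Data.Rational using (_+_; _*_; _≤_; _<_)
  open WeightedSums

  record Conic {X : Set} {m : ℕ} (P : X → Set) (f : X → Fin m → ℚ) (t : Fin m → ℚ) : Set where
    constructor conic
    field
      terms      : List (ℚ × X)
      supported  : All (P ∘ proj₂) terms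
      nonneg     : All ((0ℚ ≤_) ∘ proj₁) terms
      nontrivial : Any ((0ℚ <_) ∘ proj₁) terms
      sums-to    : ∀ i → wsum (λ x → f x i) terms ≡ t i

  Dependent : {X : Set} {m : ℕ} (P : X → Set) (f : X → Fin m → ℚ) → Set
  Dependent P f = Conic P f (λ _ → 0ℚ)

  module _ {X : Set} {m : ℕ} {P : X → Set} {f : X → Fin m → ℚ} where

    conic-single : ∀ {c x} → 0ℚ < c → P x → Conic P f (λ i → c * f x i)
    conic-single 0<c Px = conic _ (Px ∷ []) (ℚ.<⇒≤ 0<c ∷ []) (here 0<c) (λ i → ℚ.+-identityʳ _)

    conic-cons : ∀ {c x t} → 0ℚ ≤ c → P x → Conic P f t → Conic P f (λ i → c * f x i + t i)
    conic-cons {c} {x} 0≤c Px (conic cs Pcs 0≤cs pos sums) =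
      conic ((c , x) ∷ cs) (Px ∷ Pcs) (0≤c ∷ 0≤cs) (there pos) (λ i → cong (c * f x i +_) (sums i))

    conic-≗ : ∀ {t t′} → (∀ i → t i ≡ t′ i) → Conic P f t → Conic P f t′
    conic-≗ t≗t′ (conic cs Pcs 0≤cs pos sums) = conic cs Pcs 0≤cs pos (λ i → trans (sums i) (t≗t′ i))

  module _ {X Y : Set} {m : ℕ} {P : X → Set} {Q : Y → Set} {f : X → Fin m → ℚ} {g : Y → Fin m → ℚ}
           (expand : ∀ {x} → P x → Conic Q g (f x)) where

    private
      record Expansion (cs : List (ℚ × X)) : Set where
        field
          terms      : List (ℚ × Y)
          supported  : All (Q ∘ proj₂) terms
          nonneg     : All ((0ℚ ≤_) ∘ proj₁) terms
          nontrivial : Any ((0ℚ <_) ∘ proj₁) cs → Any ((0ℚ <_) ∘ proj₁) terms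
          sums-to    : ∀ i → wsum (λ y → g y i) terms ≡ wsum (λ x → f x i) cs

      expandAll : ∀ {cs} → All (P ∘ proj₂) cs → All ((0ℚ ≤_) ∘ proj₁) cs → Expansion cs
      expandAll [] [] = record
        { terms = [] ; supported = [] ; nonneg = [] ; nontrivial = λ () ; sums-to = λ _ → refl }
      expandAll {(c , x) ∷ cs} (Px ∷ Pcs) (0≤c ∷ 0≤cs) = record
        { terms      = map (map₁ (c *_)) (E.terms) ++ R.terms
        ; supported  = All.++⁺ (All.map⁺ E.supported) R.supported
        ; nonneg     = All.++⁺ (All.map⁺ (All.map (0≤* 0≤c) E.nonneg)) R.nonneg
        ; nontrivial = λ { (here 0<c) → Any.++⁺ˡ (Any.map⁺ (Any.map (0<* 0<c) E.nontrivial))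
                         ; (there pos) → Any.++⁺ʳ _ (R.nontrivial pos) }
        ; sums-to    = λ i → trans (wsum-++ _ (map (map₁ (c *_)) E.terms) R.terms)
                         (cong₂ _+_ (trans (wsum-scale c _ E.terms) (cong (c *_) (E.sums-to i)))
                                    (R.sums-to i))
        }
        where
        module E = Conic (expand Px)
        module R = Expansion (expandAll Pcs 0≤cs)

    conic-bind : ∀ {t} → Conic P f t → Conic Q g t
    conic-bind (conic cs Pcs 0≤cs pos sums) =
      conic E.terms E.supported E.nonneg (E.nontrivial pos) (λ i → trans (E.sums-to i) (sums i))
      where module E = Expansion (expandAll Pcs 0≤cs)

  module _ {X Y : Set} {m : ℕ} {P : X → Set} {Q : Y → Set} {f : X → Fin m → ℚ} {h : Y → Fin m → ℚ} where

    conic-map : ∀ {t} (g : X → Y) → (∀ {x} → P x → Q (g x)) → (∀ x i → h (g x) i ≡ f x i) →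
                Conic P f t → Conic Q h t
    conic-map g P⇒Q h∘g≗f = conic-bind λ Px →
      conic-≗ (λ i → trans (ℚ.*-identityˡ _) (h∘g≗f _ i)) (conic-single 0<1 (P⇒Q Px))

  pullback : ∀ {X Y : Set} (g : X → Y) xs {ds : List (ℚ × Y)} → All ((_∈ map g xs) ∘ proj₂) ds →
             Σ (List (ℚ × X)) λ cs → All ((_∈ xs) ∘ proj₂) cs × map (map₂ g) cs ≡ ds
  pullback g xs [] = [] , [] , refl
  pullback g xs {(c , _) ∷ _} (y∈ ∷ ds∈) with ∈.∈-map⁻ g y∈ | pullback g xs ds∈
  ... | x , x∈ , refl | cs , cs∈ , refl = (c , x) ∷ cs , x∈ ∷ cs∈ , refl

  conic-unmap : ∀ {X Y : Set} {m} {h : Y → Fin m → ℚ} {t} (g : X → Y) xs →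
                Conic (_∈ map g xs) h t → Conic (_∈ xs) (λ x → h (g x)) t
  conic-unmap g xs (conic ds ds∈ 0≤ds pos sums) with pullback g xs ds∈
  ... | cs , cs∈ , refl =
    conic cs cs∈ (All.map⁻ 0≤ds) (Any.map⁻ pos) (λ i → trans (sym (wsum-map₂ _ g cs)) (sums i))

module FourierMotzkin where
  open import Data.Rational using (_+_; _*_; -_; _≤_; _<_)
  open import Data.Rational.Solver using (module +-*-Solver)
  open +-*-Solver using (solve; _:+_; _:*_; :-_; _:=_; con)
  open WeightedSums
  open ConicCombinations

  ConicallyDependent : ∀ {m} → List (Vec ℚ m) → Set
  ConicallyDependent W = Dependent (_∈ W) lookup

  lookup-suc : ∀ {A : Set} {m} (x : Vec A (suc m)) i → lookup x (suc i) ≡ lookup (Vec.tail x) i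
  lookup-suc (_ ∷ _) i = refl

  module Elimination {m : ℕ} (W : List (Vec ℚ (suc m))) where

    head : Vec ℚ (suc m) → ℚ
    head w = lookup w zero

    -- for head p > 0 > head q, a positive combination of p and q with vanishing head
    combine : Vec ℚ (suc m) → Vec ℚ (suc m) → Vec ℚ (suc m)
    combine p q = Vec.zipWith (λ x y → x * (- head q) + head p * y) p q

    lookup-combine : ∀ p q i → lookup (combine p q) i ≡ lookup p i * (- head q) + head p * lookup q i
    lookup-combine p q i = Vec.lookup-zipWith _ i p q

    head-combine : ∀ p q → head (combine p q) ≡ 0ℚ
    head-combine p q = trans (lookup-combine p q zero)
      (solve 2 (λ a b → a :* (:- b) :+ a :* b := con 0ℚ) refl (head p) (head q))

    Wzero Wpos Wneg : List (Vec ℚ (suc m))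
    Wzero = filter (λ w → head w ℚ.≟ 0ℚ) W
    Wpos  = filter (λ w → 0ℚ ℚ.<? head w) W
    Wneg  = filter (λ w → head w ℚ.<? 0ℚ) W

    eliminated : List (Vec ℚ (suc m))
    eliminated = Wzero ++ cartesianProductWith combine Wpos Wneg

    W′ : List (Vec ℚ m)
    W′ = map Vec.tail eliminated

    zero∈eliminated : ∀ {w} → w ∈ W → head w ≡ 0ℚ → w ∈ eliminated
    zero∈eliminated w∈W h≡0 = ∈.∈-++⁺ˡ (∈.∈-filter⁺ (λ w → head w ℚ.≟ 0ℚ) w∈W h≡0)

    combine∈eliminated : ∀ {p q} → p ∈ W × 0ℚ < head p → q ∈ W × head q < 0ℚ →
                         combine p q ∈ eliminated
    combine∈eliminated (p∈W , hp>0) (q∈W , hq<0) = ∈.∈-++⁺ʳ Wzero (∈.∈-cartesianProductWith⁺ combine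
      (∈.∈-filter⁺ (λ w → 0ℚ ℚ.<? head w) p∈W hp>0)
      (∈.∈-filter⁺ (λ w → head w ℚ.<? 0ℚ) q∈W hq<0))

    head-eliminated : ∀ {x} → x ∈ eliminated → head x ≡ 0ℚ
    head-eliminated {x} x∈ with ∈.∈-++⁻ Wzero x∈
    ... | inj₁ x∈Wzero = proj₂ (∈.∈-filter⁻ (λ w → head w ℚ.≟ 0ℚ) {xs = W} x∈Wzero)
    ... | inj₂ x∈pairs with ∈.∈-cartesianProductWith⁻ combine Wpos Wneg x∈pairs
    ...   | p , q , _ , _ , refl = head-combine p q

    expand : ∀ {x} → x ∈ eliminated → Conic (_∈ W) lookup (lookup x)
    expand {x} x∈ with ∈.∈-++⁻ Wzero x∈
    ... | inj₁ x∈Wzero = conic-≗ (λ i → ℚ.*-identityˡ (lookup x i)) (conic-single 0<1 x∈W)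
      where
      x∈W : x ∈ W
      x∈W = proj₁ (∈.∈-filter⁻ (λ w → head w ℚ.≟ 0ℚ) {xs = W} x∈Wzero)
    ... | inj₂ x∈pairs with ∈.∈-cartesianProductWith⁻ combine Wpos Wneg x∈pairs
    ...   | p , q , p∈ , q∈ , refl with ∈.∈-filter⁻ (λ w → 0ℚ ℚ.<? head w) {xs = W} p∈
                                       | ∈.∈-filter⁻ (λ w → head w ℚ.<? 0ℚ) {xs = W} q∈
    ...     | p∈W , hp>0 | q∈W , hq<0 =
      conic-≗ (λ i → trans (cong (_+ head p * lookup q i) (ℚ.*-comm (- head q) (lookup p i)))
                           (sym (lookup-combine p q i)))
        (conic-cons (ℚ.<⇒≤ (ℚ.neg-antimono-< hq<0)) p∈W (conic-single hp>0 q∈W))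

    lift : ConicallyDependent W′ → ConicallyDependent W
    lift d = conic-bind expand (restoreHead (conic-unmap Vec.tail eliminated d))
      where
      restoreHead : Dependent (_∈ eliminated) (λ x → lookup (Vec.tail x)) → Dependent (_∈ eliminated) lookup
      restoreHead (conic cs cs∈ 0≤cs pos sums) = conic cs cs∈ 0≤cs pos λ
        { zero    → wsum-zeroValues head (All.map head-eliminated cs∈)
        ; (suc i) → trans (wsum-cong cs (λ x → lookup-suc x i)) (sums i) }

    module Eliminate {cs : List (ℚ × Vec ℚ (suc m))}
                     (cs∈W : All ((_∈ W) ∘ proj₂) cs) (0≤cs : All ((0ℚ ≤_) ∘ proj₁) cs)
                     (pos : Any ((0ℚ <_) ∘ proj₁) cs)
                     (balanced : ∀ i → wsum (λ x → lookup x i) cs ≡ 0ℚ) where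

      signs : SignSplit (head ∘ proj₂) cs
      signs = splitBySign (head ∘ proj₂) cs
      open SignSplit signs

      zeros∈W : All ((_∈ W) ∘ proj₂) zeros
      zeros∈W = proj₁ (SignSplit-All signs cs∈W)
      positives∈W : All ((_∈ W) ∘ proj₂) positives
      positives∈W = proj₁ (proj₂ (SignSplit-All signs cs∈W))
      negatives∈W : All ((_∈ W) ∘ proj₂) negatives
      negatives∈W = proj₂ (proj₂ (SignSplit-All signs cs∈W))
      0≤zeros : All ((0ℚ ≤_) ∘ proj₁) zeros
      0≤zeros = proj₁ (SignSplit-All signs 0≤cs)
      0≤positives : All ((0ℚ ≤_) ∘ proj₁) positives
      0≤positives = proj₁ (proj₂ (SignSplit-All signs 0≤cs))
      0≤negatives : All ((0ℚ ≤_) ∘ proj₁) negatives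
      0≤negatives = proj₂ (proj₂ (SignSplit-All signs 0≤cs))

      S : ℚ
      S = wsum head positives

      0≤S : 0ℚ ≤ S
      0≤S = wsum-nonneg head 0≤positives (All.map ℚ.<⇒≤ positives>0)

      -- the first coordinate of the balance: the positive and negative heads cancel
      negatives≡S : wsum (λ x → - head x) negatives ≡ S
      negatives≡S = begin
        wsum (λ x → - head x) negatives ≡⟨ wsum-neg head negatives ⟩
        - N                             ≡⟨ solve 2 (λ s n → :- n := s :+ :- (s :+ n)) refl S N ⟩
        S + - (S + N)                   ≡⟨ cong (λ a → S + - a) S+N≡0 ⟩
        S + - 0ℚ                        ≡⟨ ℚ.+-identityʳ S ⟩
        S                               ∎
        where
        open ≡-Reasoning
        N = wsum head negatives
        S+N≡0 : S + N ≡ 0ℚ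
        S+N≡0 = begin
          S + N                                   ≡⟨ ℚ.+-identityˡ _ ⟨
          0ℚ + (S + N)                            ≡⟨ cong (_+ (S + N)) (wsum-zeroValues head zeros≡0) ⟨
          wsum head zeros + (S + N)               ≡⟨ SignSplit-wsum signs head ⟨
          wsum head cs                            ≡⟨ balanced zero ⟩
          0ℚ                                      ∎

      pairs-coord : ∀ i → let F = λ x → lookup x i in
                    wsum F (pairsWith combine positives negatives) ≡ S * (wsum F positives + wsum F negatives)
      pairs-coord i = begin
        wsum F (pairsWith combine positives negatives)
          ≡⟨ wsum-pairsWith combine F positives negatives ⟩
        wsum (λ p → wsum (λ q → F (combine p q)) negatives) positives
          ≡⟨ wsum-cong positives inner ⟩
        wsum (λ p → S * F p + wsum F negatives * head p) positives
          ≡⟨ wsum-+ _ _ positives ⟩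
        wsum (λ p → S * F p) positives + wsum (λ p → wsum F negatives * head p) positives
          ≡⟨ cong₂ _+_ (wsum-*ˡ S F positives) (wsum-*ˡ (wsum F negatives) head positives) ⟩
        S * wsum F positives + wsum F negatives * S
          ≡⟨ cong (S * wsum F positives +_) (ℚ.*-comm (wsum F negatives) S) ⟩
        S * wsum F positives + S * wsum F negatives
          ≡⟨ ℚ.*-distribˡ-+ S _ _ ⟨
        S * (wsum F positives + wsum F negatives) ∎
        where
        open ≡-Reasoning
        F = λ x → lookup x i
        inner : ∀ p → wsum (λ q → F (combine p q)) negatives ≡ S * F p + wsum F negatives * head p
        inner p = begin
          wsum (λ q → F (combine p q)) negatives
            ≡⟨ wsum-cong negatives (λ q → lookup-combine p q i) ⟩
          wsum (λ q → F p * - head q + head p * F q) negatives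
            ≡⟨ wsum-+ _ _ negatives ⟩
          wsum (λ q → F p * - head q) negatives + wsum (λ q → head p * F q) negatives
            ≡⟨ cong₂ _+_ (wsum-*ˡ (F p) (λ q → - head q) negatives) (wsum-*ˡ (head p) F negatives) ⟩
          F p * wsum (λ q → - head q) negatives + head p * wsum F negatives
            ≡⟨ cong₂ _+_ (trans (cong (F p *_) negatives≡S) (ℚ.*-comm (F p) S)) (ℚ.*-comm (head p) _) ⟩
          S * F p + wsum F negatives * head p ∎

      tailCoords : Vec ℚ (suc m) → Fin m → ℚ
      tailCoords x i = lookup x (suc i)

      zeros∈eliminated : All ((_∈ eliminated) ∘ proj₂) zeros
      zeros∈eliminated = All.zipWith (λ (w∈W , h≡0) → zero∈eliminated w∈W h≡0) (zeros∈W , zeros≡0)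

      onlyZeros : S ≡ 0ℚ → Dependent (_∈ eliminated) tailCoords
      onlyZeros S≡0 = conic zeros zeros∈eliminated 0≤zeros nontrivial sums
        where
        positives≡0 : All ((_≡ 0ℚ) ∘ proj₁) positives
        positives≡0 = wsum≡0⇒zeroWeights head 0≤positives positives>0 S≡0
        negatives≡0 : All ((_≡ 0ℚ) ∘ proj₁) negatives
        negatives≡0 = wsum≡0⇒zeroWeights (λ x → - head x) 0≤negatives
          (All.map ℚ.neg-antimono-< negatives<0) (trans negatives≡S S≡0)
        nontrivial : Any ((0ℚ <_) ∘ proj₁) zeros
        nontrivial with SignSplit-Any signs pos
        ... | inj₁ inZeros              = inZeros
        ... | inj₂ (inj₁ inPositives)   = ⊥-elim (zeroWeights⇒¬positive positives≡0 inPositives)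
        ... | inj₂ (inj₂ inNegatives)   = ⊥-elim (zeroWeights⇒¬positive negatives≡0 inNegatives)
        sums : ∀ i → wsum (λ x → tailCoords x i) zeros ≡ 0ℚ
        sums i = begin
          wsum F zeros                                          ≡⟨ ℚ.+-identityʳ _ ⟨
          wsum F zeros + 0ℚ                                     ≡⟨ cong (wsum F zeros +_) rest≡0 ⟨
          wsum F zeros + (wsum F positives + wsum F negatives)  ≡⟨ SignSplit-wsum signs F ⟨
          wsum F cs                                             ≡⟨ balanced (suc i) ⟩
          0ℚ                                                    ∎
          where
          open ≡-Reasoning
          F = λ x → tailCoords x i
          rest≡0 : wsum F positives + wsum F negatives ≡ 0ℚ
          rest≡0 = trans (cong₂ _+_ (wsum-zeroWeights F positives≡0) (wsum-zeroWeights F negatives≡0))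
                         (ℚ.+-identityʳ 0ℚ)

      withPairs : 0ℚ < S → Dependent (_∈ eliminated) tailCoords
      withPairs 0<S = conic (scaledZeros ++ pairs) supported nonneg nontrivial sums
        where
        scaledZeros = map (map₁ (S *_)) zeros
        pairs = pairsWith combine positives negatives
        supported : All ((_∈ eliminated) ∘ proj₂) (scaledZeros ++ pairs)
        supported = All.++⁺ (All.map⁺ zeros∈eliminated)
          (All-pairsWith combine combine∈eliminated (All.zip (positives∈W , positives>0))
                                                    (All.zip (negatives∈W , negatives<0)))
        nonneg : All ((0ℚ ≤_) ∘ proj₁) (scaledZeros ++ pairs)
        nonneg = All.++⁺ (All.map⁺ (All.map (0≤* 0≤S) 0≤zeros))
                         (All-pairsWith combine 0≤* 0≤positives 0≤negatives)
        nontrivial : Any ((0ℚ <_) ∘ proj₁) (scaledZeros ++ pairs)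
        nontrivial = Any.++⁺ʳ scaledZeros (Any-pairsWith combine 0<*
          (wsum>0⇒positiveWeight head 0≤positives 0<S)
          (wsum>0⇒positiveWeight (λ x → - head x) 0≤negatives (subst (0ℚ <_) (sym negatives≡S) 0<S)))
        sums : ∀ i → wsum (λ x → tailCoords x i) (scaledZeros ++ pairs) ≡ 0ℚ
        sums i = begin
          wsum F (scaledZeros ++ pairs)
            ≡⟨ wsum-++ F scaledZeros pairs ⟩
          wsum F scaledZeros + wsum F pairs
            ≡⟨ cong₂ _+_ (wsum-scale S F zeros) (pairs-coord (suc i)) ⟩
          S * wsum F zeros + S * (wsum F positives + wsum F negatives)
            ≡⟨ ℚ.*-distribˡ-+ S _ _ ⟨
          S * (wsum F zeros + (wsum F positives + wsum F negatives))
            ≡⟨ cong (S *_) (SignSplit-wsum signs F) ⟨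
          S * wsum F cs
            ≡⟨ cong (S *_) (balanced (suc i)) ⟩
          S * 0ℚ
            ≡⟨ ℚ.*-zeroʳ S ⟩
          0ℚ ∎
          where
          open ≡-Reasoning
          F = λ x → tailCoords x i

      -- if S = 0 all weight sits on zero heads; otherwise S times the zero-head part together
      -- with weight λ_p λ_q on each combine p q balances, by pairs-coord
      dependent : Dependent (_∈ eliminated) tailCoords
      dependent with ℚ.<-cmp 0ℚ S
      ... | tri< 0<S _ _ = withPairs 0<S
      ... | tri≈ _ 0≡S _ = onlyZeros (sym 0≡S)
      ... | tri> _ _ S<0 = ⊥-elim (ℚ.<-irrefl refl (ℚ.<-≤-trans S<0 0≤S))

    eliminate : ConicallyDependent W → ConicallyDependent W′
    eliminate (conic cs cs∈W 0≤cs pos balanced) =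
      conic-map Vec.tail (∈.∈-map⁺ Vec.tail) (λ x i → sym (lookup-suc x i))
        (Eliminate.dependent cs∈W 0≤cs pos balanced)

  conicallyDependent? : ∀ {m} (W : List (Vec ℚ m)) → Dec (ConicallyDependent W)
  conicallyDependent? {zero} [] = no λ { (conic [] _ _ () _) ; (conic (_ ∷ _) (() ∷ _) _ _ _) }
  conicallyDependent? {zero} (w ∷ W) = yes (conic-≗ (λ ()) (conic-single 0<1 (here refl)))
  conicallyDependent? {suc m} W with conicallyDependent? (Elimination.W′ W)
  ... | yes d = yes (Elimination.lift W d)
  ... | no ¬d = no (¬d ∘ Elimination.eliminate W)

module Displacements where
  open import Data.Rational using (_+_; _*_; _-_; -_; _≤_; 1/_)
  open WeightedSums
  open ConicCombinations
  open import Data.Rational.Solver using (module +-*-Solver)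
  open +-*-Solver using (solve; _:+_; _:-_; _:=_)
  import Data.Integer as ℤ
  import Data.Integer.Properties as ℤ
  import Data.Rational.Unnormalised as ℚᵘ
  import Data.Rational.Unnormalised.Properties as ℚᵘ

  ℕ→ℚ-+ : ∀ a b → ℕ→ℚ (a ℕ.+ b) ≡ ℕ→ℚ a + ℕ→ℚ b
  ℕ→ℚ-+ a b = ℚ.toℚᵘ-injective (ℚᵘ.≃-trans (toℚᵘ-ℕ→ℚ (a ℕ.+ b)) (ℚᵘ.≃-sym
    (ℚᵘ.≃-trans (ℚ.toℚᵘ-homo-+ (ℕ→ℚ a) (ℕ→ℚ b))
      (ℚᵘ.≃-trans (ℚᵘ.+-cong (toℚᵘ-ℕ→ℚ a) (toℚᵘ-ℕ→ℚ b)) (ℚᵘ.*≡* numerators)))))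
    where
    toℚᵘ-ℕ→ℚ : ∀ k → ℚ.toℚᵘ (ℕ→ℚ k) ℚᵘ.≃ ℚᵘ.mkℚᵘ (ℤ.+ k) 0
    toℚᵘ-ℕ→ℚ k = ℚ.toℚᵘ-fromℚᵘ (ℚᵘ.mkℚᵘ (ℤ.+ k) 0)
    numerators : (ℤ.+ a ℤ.* ℤ.+ 1 ℤ.+ ℤ.+ b ℤ.* ℤ.+ 1) ℤ.* ℤ.+ 1 ≡ ℤ.+ (a ℕ.+ b) ℤ.* ℤ.+ 1
    numerators = begin
      (ℤ.+ a ℤ.* ℤ.+ 1 ℤ.+ ℤ.+ b ℤ.* ℤ.+ 1) ℤ.* ℤ.+ 1 ≡⟨ ℤ.*-identityʳ _ ⟩
      ℤ.+ a ℤ.* ℤ.+ 1 ℤ.+ ℤ.+ b ℤ.* ℤ.+ 1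
        ≡⟨ cong₂ ℤ._+_ (ℤ.*-identityʳ (ℤ.+ a)) (ℤ.*-identityʳ (ℤ.+ b)) ⟩
      ℤ.+ a ℤ.+ ℤ.+ b                              ≡⟨ ℤ.pos-+ a b ⟨
      ℤ.+ (a ℕ.+ b)                                ≡⟨ ℤ.*-identityʳ _ ⟨
      ℤ.+ (a ℕ.+ b) ℤ.* ℤ.+ 1                      ∎
      where open ≡-Reasoning

  ℕ→ℚ-−-cong : ∀ {a b c d} → a ℕ.+ d ≡ c ℕ.+ b → ℕ→ℚ a - ℕ→ℚ b ≡ ℕ→ℚ c - ℕ→ℚ d
  ℕ→ℚ-−-cong {a} {b} {c} {d} a+d≡c+b = begin
    ℕ→ℚ a - ℕ→ℚ b
      ≡⟨ solve 4 (λ a b c d → a :- b := ((a :+ d) :- (c :+ b)) :+ (c :- d)) refl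
                 (ℕ→ℚ a) (ℕ→ℚ b) (ℕ→ℚ c) (ℕ→ℚ d) ⟩
    (ℕ→ℚ a + ℕ→ℚ d) - (ℕ→ℚ c + ℕ→ℚ b) + (ℕ→ℚ c - ℕ→ℚ d)
      ≡⟨ cong (_+ (ℕ→ℚ c - ℕ→ℚ d)) cancel ⟩
    0ℚ + (ℕ→ℚ c - ℕ→ℚ d)
      ≡⟨ ℚ.+-identityˡ _ ⟩
    ℕ→ℚ c - ℕ→ℚ d ∎
    where
    open ≡-Reasoning
    cancel : (ℕ→ℚ a + ℕ→ℚ d) - (ℕ→ℚ c + ℕ→ℚ b) ≡ 0ℚ
    cancel = begin
      (ℕ→ℚ a + ℕ→ℚ d) - (ℕ→ℚ c + ℕ→ℚ b) ≡⟨ cong₂ _-_ (ℕ→ℚ-+ a d) (ℕ→ℚ-+ c b) ⟨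
      ℕ→ℚ (a ℕ.+ d) - ℕ→ℚ (c ℕ.+ b)     ≡⟨ cong ((_- ℕ→ℚ (c ℕ.+ b)) ∘ ℕ→ℚ) a+d≡c+b ⟩
      ℕ→ℚ (c ℕ.+ b) - ℕ→ℚ (c ℕ.+ b)     ≡⟨ ℚ.+-inverseʳ (ℕ→ℚ (c ℕ.+ b)) ⟩
      0ℚ                                ∎

  δ : ∀ {n} → Vec ℕ n → Vec ℕ n → Fin n → ℚ
  δ u v i = ℕ→ℚ (lookup v i) - ℕ→ℚ (lookup u i)

  module _ {n : ℕ} where

    δ-translate : ∀ (u v u′ v′ : Vec ℕ n) i →
                  lookup v i ℕ.+ lookup u′ i ≡ lookup v′ i ℕ.+ lookup u i → δ u v i ≡ δ u′ v′ i
    δ-translate u v u′ v′ i = ℕ→ℚ-−-cong {lookup v i} {lookup u i} {lookup v′ i} {lookup u′ i}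

    δ-trans : ∀ (u v w : Vec ℕ n) i → δ u v i + δ v w i ≡ δ u w i
    δ-trans u v w i = solve 3 (λ a b c → (b :- a) :+ (c :- b) := c :- a) refl
      (ℕ→ℚ (lookup u i)) (ℕ→ℚ (lookup v i)) (ℕ→ℚ (lookup w i))

    δ-refl : ∀ (u : Vec ℕ n) i → δ u u i ≡ 0ℚ
    δ-refl u i = ℚ.+-inverseʳ (ℕ→ℚ (lookup u i))

    ConvexCombinationOf : (Vec ℕ n → Set) → Vec ℕ n → Set
    ConvexCombinationOf P u = Σ (List (ℚ × Vec ℕ n)) λ cs → All (P ∘ proj₂) cs × IsConvComb cs u

    module _ {P : Vec ℕ n → Set} {u : Vec ℕ n} where

      convex⇒dependent : ConvexCombinationOf P u → Dependent P (δ u)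
      convex⇒dependent (cs , Pcs , 0≤cs , total≡1 , coords) = conic cs Pcs 0≤cs nontrivial sums
        where
        nontrivial : Any ((0ℚ ℚ.<_) ∘ proj₁) cs
        nontrivial = wsum>0⇒positiveWeight (λ _ → 1ℚ) 0≤cs
          (subst (0ℚ ℚ.<_) (sym (trans (wsum-const 1ℚ cs) (cong (_* 1ℚ) total≡1))) 0<1)
        sums : ∀ i → wsum (λ v → δ u v i) cs ≡ 0ℚ
        sums i = begin
          wsum (λ v → δ u v i) cs
            ≡⟨ wsum-+ _ _ cs ⟩
          wsum (λ v → ℕ→ℚ (lookup v i)) cs + wsum (λ _ → - uᵢ) cs
            ≡⟨ cong₂ _+_ (coords i) (wsum-const (- uᵢ) cs) ⟩
          uᵢ + sumℚ (map proj₁ cs) * - uᵢ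
            ≡⟨ cong (λ t → uᵢ + t * - uᵢ) total≡1 ⟩
          uᵢ + 1ℚ * - uᵢ
            ≡⟨ cong (uᵢ +_) (ℚ.*-identityˡ (- uᵢ)) ⟩
          uᵢ - uᵢ
            ≡⟨ ℚ.+-inverseʳ uᵢ ⟩
          0ℚ ∎
          where
          open ≡-Reasoning
          uᵢ = ℕ→ℚ (lookup u i)

      dependent⇒convex : Dependent P (δ u) → ConvexCombinationOf P u
      dependent⇒convex (conic cs Pcs 0≤cs pos sums) =
        map (map₁ (r *_)) cs , All.map⁺ Pcs , All.map⁺ (All.map (0≤* 0≤r) 0≤cs) , total≡1 , coords
        where
        s = sumℚ (map proj₁ cs)
        instance
          s>0 : ℚ.Positive s
          s>0 = ℚ.positive (0<totalWeight 0≤cs pos)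
          s≢0 : ℚ.NonZero s
          s≢0 = ℚ.pos⇒nonZero s
        r = 1/ s
        0≤r : 0ℚ ≤ r
        0≤r = ℚ.<⇒≤ (ℚ.positive⁻¹ r {{ℚ.1/pos⇒pos s}})
        total≡1 : sumℚ (map proj₁ (map (map₁ (r *_)) cs)) ≡ 1ℚ
        total≡1 = trans (totalWeight-scale r cs) (ℚ.*-inverseˡ s)
        coords : ∀ i → wsum (λ v → ℕ→ℚ (lookup v i)) (map (map₁ (r *_)) cs) ≡ ℕ→ℚ (lookup u i)
        coords i = begin
          wsum (λ v → ℕ→ℚ (lookup v i)) (map (map₁ (r *_)) cs)
            ≡⟨ wsum-scale r _ cs ⟩
          r * wsum (λ v → ℕ→ℚ (lookup v i)) cs
            ≡⟨ cong (r *_) (trans (wsum-cong cs split) (wsum-+ _ _ cs)) ⟩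
          r * (wsum (λ v → δ u v i) cs + wsum (λ _ → uᵢ) cs)
            ≡⟨ cong (λ a → r * (a + wsum (λ _ → uᵢ) cs)) (sums i) ⟩
          r * (0ℚ + wsum (λ _ → uᵢ) cs)
            ≡⟨ cong (r *_) (trans (ℚ.+-identityˡ _) (wsum-const uᵢ cs)) ⟩
          r * (s * uᵢ)
            ≡⟨ ℚ.*-assoc r s uᵢ ⟨
          r * s * uᵢ
            ≡⟨ cong (_* uᵢ) (ℚ.*-inverseˡ s) ⟩
          1ℚ * uᵢ
            ≡⟨ ℚ.*-identityˡ uᵢ ⟩
          uᵢ ∎
          where
          open ≡-Reasoning
          uᵢ = ℕ→ℚ (lookup u i)
          split : ∀ v → ℕ→ℚ (lookup v i) ≡ δ u v i + uᵢ
          split v = solve 2 (λ a b → a := (a :- b) :+ b) refl (ℕ→ℚ (lookup v i)) uᵢ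

open import Data.Nat using (_+_; _*_; _∸_; _≤_; _<_; z≤n; s≤s)
open import Data.Nat.Solver using (module +-*-Solver)
open +-*-Solver using (solve; _:+_; _:*_; _:=_)
open WeightedSums using (0<1)
open ConicCombinations
open FourierMotzkin using (conicallyDependent?)
open Displacements

sumFin-≥ : ∀ {n} (h : Fin n → ℕ) i → h i ≤ sumFin h
sumFin-≥ h zero = ℕ.m≤m+n _ _
sumFin-≥ h (suc i) = ℕ.≤-trans (sumFin-≥ (h ∘ suc) i) (ℕ.m≤n+m _ _)

sumFin-≤ : ∀ {n} (h : Fin n → ℕ) {B} → (∀ j → h j ≤ B) → sumFin h ≤ n * B
sumFin-≤ {zero} h h≤B = z≤n
sumFin-≤ {suc n} h h≤B = ℕ.+-mono-≤ (h≤B zero) (sumFin-≤ (h ∘ suc) (h≤B ∘ suc))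

sumFin-≤-except : ∀ {n} (h : Fin n → ℕ) {B} i → (∀ j → j ≢ i → h j ≤ B) → sumFin h ≤ h i + n * B
sumFin-≤-except {suc n} h {B} zero h≤B =
  ℕ.+-monoʳ-≤ (h zero) (ℕ.≤-trans (sumFin-≤ (h ∘ suc) (λ j → h≤B (suc j) λ ())) (ℕ.m≤n+m _ B))
sumFin-≤-except {suc n} h {B} (suc i) h≤B = begin
  h zero + sumFin (h ∘ suc)
    ≤⟨ ℕ.+-mono-≤ (h≤B zero λ ()) (sumFin-≤-except (h ∘ suc) i λ j → h≤B (suc j) ∘ (_∘ Fin.suc-injective)) ⟩
  B + (h (suc i) + n * B)
    ≡⟨ solve 3 (λ b x y → b :+ (x :+ y) := x :+ (b :+ y)) refl B (h (suc i)) (n * B) ⟩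
  h (suc i) + (B + n * B) ∎
  where open ℕ.≤-Reasoning

·-updateAt : ∀ {n} (A : Fin n → ℕ) (u : Vec ℕ n) i (f : ℕ → ℕ) →
             A · Vec.updateAt u i f + A i * lookup u i ≡ A · u + A i * f (lookup u i)
·-updateAt A (x ∷ u) zero f =
  solve 4 (λ a y s z → (a :* y :+ s) :+ a :* z := (a :* z :+ s) :+ a :* y) refl (A zero) (f x) ((A ∘ suc) · u) x
·-updateAt A (x ∷ u) (suc i) f = begin
  A zero * x + (A ∘ suc) · Vec.updateAt u i f + A (suc i) * lookup u i
    ≡⟨ ℕ.+-assoc (A zero * x) _ _ ⟩
  A zero * x + ((A ∘ suc) · Vec.updateAt u i f + A (suc i) * lookup u i)
    ≡⟨ cong (A zero * x +_) (·-updateAt (A ∘ suc) u i f) ⟩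
  A zero * x + ((A ∘ suc) · u + A (suc i) * f (lookup u i))
    ≡⟨ ℕ.+-assoc (A zero * x) _ _ ⟨
  A zero * x + (A ∘ suc) · u + A (suc i) * f (lookup u i) ∎
  where open ≡-Reasoning

module _ {n : ℕ} where

  raise lower : Fin n → ℕ → Vec ℕ n → Vec ℕ n
  raise i s u = Vec.updateAt u i (_+ s)
  lower i s u = Vec.updateAt u i (_∸ s)

  lower-raise : ∀ i s (u : Vec ℕ n) → lower i s (raise i s u) ≡ u
  lower-raise i s u = trans (Vec.updateAt-updateAt i u)
    (Vec.updateAt-id-local i u (ℕ.m+n∸n≡m (lookup u i) s))

  raise-lower : ∀ i s (u : Vec ℕ n) → s ≤ lookup u i → raise i s (lower i s u) ≡ u
  raise-lower i s u s≤uᵢ = trans (Vec.updateAt-updateAt i u) (Vec.updateAt-id-local i u (ℕ.m∸n+n≡m s≤uᵢ))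

  raise-injective : ∀ i s {u v : Vec ℕ n} → raise i s u ≡ raise i s v → u ≡ v
  raise-injective i s {u} {v} eq = begin
    u                      ≡⟨ lower-raise i s u ⟨
    lower i s (raise i s u) ≡⟨ cong (lower i s) eq ⟩
    lower i s (raise i s v) ≡⟨ lower-raise i s v ⟩
    v                      ∎
    where open ≡-Reasoning


  lookup-raise : ∀ i s (u : Vec ℕ n) → lookup (raise i s u) i ≡ lookup u i + s
  lookup-raise i s u = Vec.lookup∘updateAt i u

  lookup-lower : ∀ i s (u : Vec ℕ n) → lookup (lower i s u) i ≡ lookup u i ∸ s
  lookup-lower i s u = Vec.lookup∘updateAt i u

  lookup-raise-≢ : ∀ {i j} s (u : Vec ℕ n) → j ≢ i → lookup (raise i s u) j ≡ lookup u j
  lookup-raise-≢ {i} {j} s u j≢i = Vec.lookup∘updateAt′ j i j≢i u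

  lookup-lower-≢ : ∀ {i j} s (u : Vec ℕ n) → j ≢ i → lookup (lower i s u) j ≡ lookup u j
  lookup-lower-≢ {i} {j} s u j≢i = Vec.lookup∘updateAt′ j i j≢i u

  δ-raise : ∀ i s (u v : Vec ℕ n) l → δ (raise i s u) (raise i s v) l ≡ δ u v l
  δ-raise i s u v l = δ-translate (raise i s u) (raise i s v) u v l (shifted (l Fin.≟ i))
    where
    shifted : Dec (l ≡ i) → lookup (raise i s v) l + lookup u l ≡ lookup v l + lookup (raise i s u) l
    shifted (yes refl) = begin
      lookup (raise i s v) i + lookup u i ≡⟨ cong (_+ lookup u i) (lookup-raise i s v) ⟩
      lookup v i + s + lookup u i         ≡⟨ ℕ.+-assoc (lookup v i) s _ ⟩
      lookup v i + (s + lookup u i)       ≡⟨ cong (lookup v i +_) (ℕ.+-comm s (lookup u i)) ⟩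
      lookup v i + (lookup u i + s)       ≡⟨ cong (lookup v i +_) (lookup-raise i s u) ⟨
      lookup v i + lookup (raise i s u) i ∎
      where open ≡-Reasoning
    shifted (no l≢i) = cong₂ _+_ (lookup-raise-≢ s v l≢i) (sym (lookup-raise-≢ s u l≢i))

module _ {n : ℕ} (A : Fin n → ℕ) where

  ·-raise : ∀ i s (u : Vec ℕ n) → A · raise i s u ≡ A · u + A i * s
  ·-raise i s u = ℕ.+-cancelʳ-≡ (A i * lookup u i) _ _ (begin
    A · raise i s u + A i * lookup u i   ≡⟨ ·-updateAt A u i (_+ s) ⟩
    A · u + A i * (lookup u i + s)       ≡⟨ cong (A · u +_) (ℕ.*-distribˡ-+ (A i) (lookup u i) s) ⟩
    A · u + (A i * lookup u i + A i * s)
      ≡⟨ solve 3 (λ d x y → d :+ (x :+ y) := d :+ y :+ x) refl (A · u) (A i * lookup u i) (A i * s) ⟩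
    A · u + A i * s + A i * lookup u i   ∎)
    where open ≡-Reasoning

  ·-lower : ∀ i s (u : Vec ℕ n) → s ≤ lookup u i → A · lower i s u + A i * s ≡ A · u
  ·-lower i s u s≤uᵢ = trans (sym (·-raise i s (lower i s u))) (cong (A ·_) (raise-lower i s u s≤uᵢ))

  exchange : Fin n → Fin n → Vec ℕ n → Vec ℕ n
  exchange p q u = lower q (A p) (raise p (A q) u)

  ·-exchange : ∀ {p q} → p ≢ q → ∀ u → A p ≤ lookup u q → A · exchange p q u ≡ A · u
  ·-exchange {p} {q} p≢q u Ap≤u = ℕ.+-cancelʳ-≡ (A q * A p) _ _ (begin
    A · exchange p q u + A q * A p
      ≡⟨ ·-lower q (A p) (raise p (A q) u) (subst (A p ≤_) (sym (lookup-raise-≢ (A q) u (p≢q ∘ sym))) Ap≤u) ⟩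
    A · raise p (A q) u            ≡⟨ ·-raise p (A q) u ⟩
    A · u + A p * A q              ≡⟨ cong (A · u +_) (ℕ.*-comm (A p) (A q)) ⟩
    A · u + A q * A p              ∎)
    where open ≡-Reasoning

  lookup-exchange-raised : ∀ {p q} → p ≢ q → ∀ u → lookup (exchange p q u) p ≡ lookup u p + A q
  lookup-exchange-raised {p} {q} p≢q u = trans (lookup-lower-≢ (A p) (raise p (A q) u) p≢q) (lookup-raise p (A q) u)

  lookup-exchange-lowered : ∀ {p q} → p ≢ q → ∀ u → lookup (exchange p q u) q ≡ lookup u q ∸ A p
  lookup-exchange-lowered {p} {q} p≢q u =
    trans (lookup-lower q (A p) (raise p (A q) u)) (cong (_∸ A p) (lookup-raise-≢ (A q) u (p≢q ∘ sym)))

  lookup-exchange-other : ∀ {p q} u {l} → l ≢ p → l ≢ q → lookup (exchange p q u) l ≡ lookup u l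
  lookup-exchange-other {p} {q} u l≢p l≢q =
    trans (lookup-lower-≢ (A p) (raise p (A q) u) l≢q) (lookup-raise-≢ (A q) u l≢p)

  exchange-opposite : ∀ {p q} → p ≢ q → ∀ u v → A p ≤ lookup u q → A q ≤ lookup v p → ∀ l →
                      lookup (exchange p q u) l + lookup (exchange q p v) l ≡ lookup u l + lookup v l
  exchange-opposite {p} {q} p≢q u v Ap≤u Aq≤v l with l Fin.≟ p | l Fin.≟ q
  ... | yes refl | yes refl = ⊥-elim (p≢q refl)
  ... | yes refl | no _ = begin
    lookup (exchange p q u) p + lookup (exchange q p v) p
      ≡⟨ cong₂ _+_ (lookup-exchange-raised p≢q u) (lookup-exchange-lowered (p≢q ∘ sym) v) ⟩
    lookup u p + A q + (lookup v p ∸ A q)   ≡⟨ ℕ.+-assoc (lookup u p) (A q) _ ⟩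
    lookup u p + (A q + (lookup v p ∸ A q)) ≡⟨ cong (lookup u p +_) (ℕ.m+[n∸m]≡n Aq≤v) ⟩
    lookup u p + lookup v p                 ∎
    where open ≡-Reasoning
  ... | no _ | yes refl = begin
    lookup (exchange p q u) q + lookup (exchange q p v) q
      ≡⟨ cong₂ _+_ (lookup-exchange-lowered p≢q u) (lookup-exchange-raised (p≢q ∘ sym) v) ⟩
    (lookup u q ∸ A p) + (lookup v q + A p) ≡⟨ cong ((lookup u q ∸ A p) +_) (ℕ.+-comm (lookup v q) (A p)) ⟩
    (lookup u q ∸ A p) + (A p + lookup v q) ≡⟨ ℕ.+-assoc (lookup u q ∸ A p) (A p) _ ⟨
    (lookup u q ∸ A p) + A p + lookup v q   ≡⟨ cong (_+ lookup v q) (ℕ.m∸n+n≡m Ap≤u) ⟩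
    lookup u q + lookup v q                 ∎
    where open ≡-Reasoning
  ... | no l≢p | no l≢q = cong₂ _+_ (lookup-exchange-other u l≢p l≢q) (lookup-exchange-other v l≢q l≢p)

boundedVectors : (n B : ℕ) → List (Vec ℕ n)
boundedVectors zero B = [] ∷ []
boundedVectors (suc n) B = cartesianProductWith _∷_ (List.upTo (suc B)) (boundedVectors n B)

∈-boundedVectors : ∀ {n B} (v : Vec ℕ n) → (∀ i → lookup v i ≤ B) → v ∈ boundedVectors n B
∈-boundedVectors [] v≤B = here refl
∈-boundedVectors (x ∷ v) v≤B =
  ∈.∈-cartesianProductWith⁺ _∷_ (∈.∈-upTo⁺ (s≤s (v≤B zero))) (∈-boundedVectors v (v≤B ∘ suc))

boundedVectors-unique : ∀ n B → Unique (boundedVectors n B)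
boundedVectors-unique zero B = [] ∷ []
boundedVectors-unique (suc n) B =
  Unique.cartesianProductWith⁺ _∷_ Vec.∷-injective (Unique.upTo⁺ (suc B)) (boundedVectors-unique n B)

module Fibres {n : ℕ} (A : Fin n → ℕ) (A>0 : ∀ i → NonZero (A i)) where

  lookup-≤-· : ∀ v i → lookup v i ≤ A · v
  lookup-≤-· v i = ℕ.≤-trans (ℕ.m≤n*m (lookup v i) (A i) {{A>0 i}}) (sumFin-≥ (λ j → A j * lookup v j) i)

  fibre : ℕ → List (Vec ℕ n)
  fibre c = filter (λ v → A · v ℕ.≟ c) (boundedVectors n c)

  ∈-fibre⁺ : ∀ {c v} → A · v ≡ c → v ∈ fibre c
  ∈-fibre⁺ {c} {v} Av≡c = ∈.∈-filter⁺ (λ v → A · v ℕ.≟ c)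
    (∈-boundedVectors v (λ i → subst (lookup v i ≤_) Av≡c (lookup-≤-· v i))) Av≡c

  ∈-fibre⁻ : ∀ {c v} → v ∈ fibre c → A · v ≡ c
  ∈-fibre⁻ {c} v∈ = proj₂ (∈.∈-filter⁻ (λ v → A · v ℕ.≟ c) {xs = boundedVectors n c} v∈)

  fibre-unique : ∀ c → Unique (fibre c)
  fibre-unique c = Unique.filter⁺ (λ v → A · v ℕ.≟ c) (boundedVectors-unique n c)

  InFibreExcept : ℕ → Vec ℕ n → Vec ℕ n → Set
  InFibreExcept c u v = A · v ≡ c × v ≢ u

  -- u is in the convex hull of the rest of its fibre, with weights not yet normalised
  NonVertex : ℕ → Vec ℕ n → Set
  NonVertex c u = Dependent (InFibreExcept c u) (δ u)

  vertex⇒¬nonVertex : ∀ {c u} → IsVertex A c u → ¬ NonVertex c u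
  vertex⇒¬nonVertex {c} {u} (_ , ¬convex) = ¬convex ∘ dependent⇒convex {P = InFibreExcept c u} {u}

  ¬nonVertex⇒vertex : ∀ {c u} → A · u ≡ c → ¬ NonVertex c u → IsVertex A c u
  ¬nonVertex⇒vertex {c} {u} Au≡c ¬nonVertex = Au≡c , ¬nonVertex ∘ convex⇒dependent {P = InFibreExcept c u} {u}

  others : ℕ → Vec ℕ n → List (Vec ℕ n)
  others c u = filter (λ v → ¬? (Vec.≡-dec ℕ._≟_ v u)) (fibre c)

  ∈-others⁺ : ∀ {c u v} → InFibreExcept c u v → v ∈ others c u
  ∈-others⁺ {c} {u} (Av≡c , v≢u) =
    ∈.∈-filter⁺ (λ v → ¬? (Vec.≡-dec ℕ._≟_ v u)) (∈-fibre⁺ Av≡c) v≢u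

  ∈-others⁻ : ∀ {c u v} → v ∈ others c u → InFibreExcept c u v
  ∈-others⁻ {c} {u} v∈ with ∈.∈-filter⁻ (λ v → ¬? (Vec.≡-dec ℕ._≟_ v u)) {xs = fibre c} v∈
  ... | v∈fibre , v≢u = ∈-fibre⁻ v∈fibre , v≢u

  nonVertex? : ∀ c u → Dec (NonVertex c u)
  nonVertex? c u with conicallyDependent? (map (Vec.tabulate ∘ δ u) (others c u))
  ... | yes dependent = yes (conic-map id ∈-others⁻ (λ v i → sym (Vec.lookup∘tabulate (δ u v) i))
                              (conic-unmap (Vec.tabulate ∘ δ u) (others c u) dependent))
  ... | no independent = no (independent ∘ conic-map (Vec.tabulate ∘ δ u) (∈.∈-map⁺ _ ∘ ∈-others⁺)
                                                   (λ v i → Vec.lookup∘tabulate (δ u v) i))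

  isVertex? : ∀ c u → Dec (IsVertex A c u)
  isVertex? c u with A · u ℕ.≟ c | nonVertex? c u
  ... | no Au≢c   | _             = no (Au≢c ∘ proj₁)
  ... | yes _     | yes nonVertex = no λ isVertex → vertex⇒¬nonVertex isVertex nonVertex
  ... | yes Au≡c  | no ¬nonVertex = yes (¬nonVertex⇒vertex Au≡c ¬nonVertex)

  vertices : ℕ → List (Vec ℕ n)
  vertices c = filter (isVertex? c) (fibre c)

  vertices-count : ∀ c → VertexCount A c (length (vertices c))
  vertices-count c = vertices c , Unique.filter⁺ (isVertex? c) (fibre-unique c) , refl , λ u →
    (λ u∈ → proj₂ (∈.∈-filter⁻ (isVertex? c) {xs = fibre c} u∈)) ,
    (λ isVertex → ∈.∈-filter⁺ (isVertex? c) (∈-fibre⁺ (proj₁ isVertex)) isVertex)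

raiseFirstAbove : ℕ → ∀ {n} → (Fin n → ℕ) → Vec ℕ n → Vec ℕ n
raiseFirstAbove M s [] = []
raiseFirstAbove M s (x ∷ xs) with M ℕ.≤? x
... | yes _ = x + s zero ∷ xs
... | no _  = x ∷ raiseFirstAbove M (s ∘ suc) xs

-- the raised coordinate is still the first one ≥ M, so it can be located and lowered again
raiseFirstAbove-injective : ∀ M {n} (s : Fin n → ℕ) {u v} →
                            raiseFirstAbove M s u ≡ raiseFirstAbove M s v → u ≡ v
raiseFirstAbove-injective M s {[]} {[]} _ = refl
raiseFirstAbove-injective M s {x ∷ xs} {y ∷ ys} eq with M ℕ.≤? x | M ℕ.≤? y
... | yes _ | yes _ = cong₂ _∷_ (ℕ.+-cancelʳ-≡ (s zero) x y (Vec.∷-injectiveˡ eq)) (Vec.∷-injectiveʳ eq)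
... | yes M≤x | no M≰y =
  ⊥-elim (M≰y (subst (M ≤_) (Vec.∷-injectiveˡ eq) (ℕ.≤-trans M≤x (ℕ.m≤m+n x (s zero)))))
... | no M≰x | yes M≤y =
  ⊥-elim (M≰x (subst (M ≤_) (sym (Vec.∷-injectiveˡ eq)) (ℕ.≤-trans M≤y (ℕ.m≤m+n y (s zero)))))
... | no _ | no _ =
  cong₂ _∷_ (Vec.∷-injectiveˡ eq) (raiseFirstAbove-injective M (s ∘ suc) (Vec.∷-injectiveʳ eq))

raiseFirstAbove-only : ∀ M {n} (s : Fin n → ℕ) (u : Vec ℕ n) i →
                       M ≤ lookup u i → (∀ j → j ≢ i → lookup u j < M) →
                       raiseFirstAbove M s u ≡ raise i (s i) u
raiseFirstAbove-only M s (x ∷ xs) zero M≤x _ with M ℕ.≤? x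
... | yes _  = refl
... | no M≰x = ⊥-elim (M≰x M≤x)
raiseFirstAbove-only M s (x ∷ xs) (suc i) M≤xᵢ small with M ℕ.≤? x
... | yes M≤x = ⊥-elim (ℕ.<⇒≱ (small zero λ ()) M≤x)
... | no _    =
  cong (x ∷_) (raiseFirstAbove-only M (s ∘ suc) xs i M≤xᵢ λ j → small (suc j) ∘ (_∘ Fin.suc-injective))

vertexCount-bijection : ∀ {n} {A : Fin n → ℕ} {c c′ k} (f : Vec ℕ n → Vec ℕ n) →
                        (∀ {u v} → f u ≡ f v → u ≡ v) →
                        (∀ {u} → IsVertex A c u → IsVertex A c′ (f u)) →
                        (∀ {v} → IsVertex A c′ v → ∃ λ u → IsVertex A c u × f u ≡ v) →
                        VertexCount A c k → VertexCount A c′ k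
vertexCount-bijection {A = A} {c′ = c′} f f-injective to from (vs , unique , length≡k , vs-spec) =
  map f vs , Unique.map⁺ f-injective unique , trans (List.length-map f vs) length≡k , λ v →
    (λ v∈ → let (u , u∈ , v≡fu) = ∈.∈-map⁻ f v∈ in
            subst (IsVertex A c′) (sym v≡fu) (to (proj₁ (vs-spec u) u∈))) ,
    (λ isVertex → let (u , isVertexᵤ , fu≡v) = from isVertex in
                  subst (_∈ map f vs) fu≡v (∈.∈-map⁺ f (proj₂ (vs-spec u) isVertexᵤ)))

∣-lcmAll : ∀ {n} (A : Fin n → ℕ) i → A i ∣ lcmAll A
∣-lcmAll A zero = m∣lcm[m,n] (A zero) _
∣-lcmAll A (suc i) = ∣-trans (∣-lcmAll (A ∘ suc) i) (n∣lcm[m,n] (A zero) _)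

module Periodicity {n : ℕ} (A : Fin n → ℕ) (A>0 : ∀ i → NonZero (A i)) where
  open Fibres A A>0

  M : ℕ
  M = suc (sumFin A)

  A≤M : ∀ i → A i ≤ M
  A≤M i = ℕ.≤-trans (sumFin-≥ A i) (ℕ.n≤1+n _)

  0<A : ∀ i → 0 < A i
  0<A i = ℕ.>-nonZero⁻¹ (A i) {{A>0 i}}

  L : ℕ
  L = lcmAll A

  d : Fin n → ℕ
  d i = _∣_.quotient (∣-lcmAll A i)

  A*d≡L : ∀ i → A i * d i ≡ L
  A*d≡L i = trans (ℕ.*-comm (A i) (d i)) (sym (_∣_.equality (∣-lcmAll A i)))

  d≤L : ∀ i → d i ≤ L
  d≤L i = subst (d i ≤_) (A*d≡L i) (ℕ.m≤n*m (d i) (A i) {{A>0 i}})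

  -- coordinates below M are small; a vertex over c ≥ N₀ has exactly one coordinate ≥ R, and
  -- R = L + M keeps it ≥ M after lowering it by d i ≤ L
  R : ℕ
  R = L + M

  N₀ : ℕ
  N₀ = n * (M * M) + M * R

  shift : Fin n → Vec ℕ n → Vec ℕ n
  shift i = raise i (d i)

  ·-shift : ∀ i u → A · shift i u ≡ A · u + L
  ·-shift i u = trans (·-raise A i (d i) u) (cong (A · u +_) (A*d≡L i))

  exchange-≢ : ∀ {p q} → p ≢ q → ∀ u → exchange A p q u ≢ u
  exchange-≢ {p} {q} p≢q u eq = ℕ.<-irrefl
    (trans (sym (cong (λ w → lookup w p) eq)) (lookup-exchange-raised A p≢q u))
    (ℕ.m<m+n (lookup u p) (0<A q))

  ·-≤-except : ∀ u i → (∀ j → j ≢ i → lookup u j < M) → A · u ≤ A i * lookup u i + n * (M * M)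
  ·-≤-except u i small = sumFin-≤-except (λ j → A j * lookup u j) i
    (λ j j≢i → ℕ.*-mono-≤ (A≤M j) (ℕ.<⇒≤ (small j j≢i)))

  ·-≤-small : ∀ u → (∀ j → lookup u j < M) → A · u ≤ n * (M * M)
  ·-≤-small u small = sumFin-≤ (λ j → A j * lookup u j) (λ j → ℕ.*-mono-≤ (A≤M j) (ℕ.<⇒≤ (small j)))

  n*M*M<N₀ : n * (M * M) < N₀
  n*M*M<N₀ = ℕ.m<m+n (n * (M * M)) (ℕ.<-≤-trans 0<R (ℕ.m≤m+n R _))
    where
    0<R : 0 < R
    0<R = ℕ.<-≤-trans (s≤s z≤n) (ℕ.m≤n+m M L)

  -- u is the midpoint of exchange A i j u and exchange A j i u
  nonVertex-twoLarge : ∀ {c u i j} → i ≢ j → A j ≤ lookup u i → A i ≤ lookup u j → A · u ≡ c →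
                       NonVertex c u
  nonVertex-twoLarge {c} {u} {i} {j} i≢j Aj≤uᵢ Ai≤uⱼ Au≡c =
    conic-≗ midpoint (conic-cons (ℚ.<⇒≤ 0<1) x-in (conic-single 0<1 y-in))
    where
    x = exchange A i j u
    y = exchange A j i u
    x-in : InFibreExcept c u x
    x-in = trans (·-exchange A i≢j u Ai≤uⱼ) Au≡c , exchange-≢ i≢j u
    y-in : InFibreExcept c u y
    y-in = trans (·-exchange A (i≢j ∘ sym) u Aj≤uᵢ) Au≡c , exchange-≢ (i≢j ∘ sym) u
    midpoint : ∀ l → 1ℚ ℚ.* δ u x l ℚ.+ 1ℚ ℚ.* δ u y l ≡ 0ℚ
    midpoint l = begin
      1ℚ ℚ.* δ u x l ℚ.+ 1ℚ ℚ.* δ u y l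
        ≡⟨ cong₂ ℚ._+_ (ℚ.*-identityˡ (δ u x l)) (ℚ.*-identityˡ (δ u y l)) ⟩
      δ u x l ℚ.+ δ u y l
        ≡⟨ cong (ℚ._+ δ u y l) (δ-translate u x y u l (exchange-opposite A i≢j u u Ai≤uⱼ Aj≤uᵢ l)) ⟩
      δ y u l ℚ.+ δ u y l               ≡⟨ δ-trans y u y l ⟩
      δ y y l                           ≡⟨ δ-refl y l ⟩
      0ℚ                                ∎
      where open ≡-Reasoning

  LargeOnlyAt : Fin n → Vec ℕ n → Set
  LargeOnlyAt i u = R ≤ lookup u i × (∀ j → j ≢ i → lookup u j < M)

  -- a second coordinate ≥ M would allow an exchange, and small coordinates cannot reach the level N₀
  vertex-shape : ∀ {c u} → N₀ ≤ c → IsVertex A c u → ∃ λ i → LargeOnlyAt i u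
  vertex-shape {c} {u} N₀≤c isVertex@(Au≡c , _) with Fin.any? (λ i → M ℕ.≤? lookup u i)
  ... | no noneLarge =
    ⊥-elim (ℕ.<⇒≱ (ℕ.≤-<-trans (subst (_≤ n * (M * M)) Au≡c (·-≤-small u small)) n*M*M<N₀) N₀≤c)
    where
    small : ∀ j → lookup u j < M
    small j = ℕ.≰⇒> (λ M≤uⱼ → noneLarge (j , M≤uⱼ))
  ... | yes (i , M≤uᵢ) = i , R≤uᵢ , othersSmall
    where
    othersSmall : ∀ j → j ≢ i → lookup u j < M
    othersSmall j j≢i = ℕ.≰⇒> λ M≤uⱼ → vertex⇒¬nonVertex isVertex
      (nonVertex-twoLarge (j≢i ∘ sym) (ℕ.≤-trans (A≤M j) M≤uᵢ) (ℕ.≤-trans (A≤M i) M≤uⱼ) Au≡c)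
    R≤uᵢ : R ≤ lookup u i
    R≤uᵢ = ℕ.≮⇒≥ λ uᵢ<R → ℕ.<⇒≱ (c<N₀ uᵢ<R) N₀≤c
      where
      c<N₀ : lookup u i < R → c < N₀
      c<N₀ uᵢ<R = begin-strict
        c                                  ≡⟨ Au≡c ⟨
        A · u                              ≤⟨ ·-≤-except u i othersSmall ⟩
        A i * lookup u i + n * (M * M)     ≤⟨ ℕ.+-monoˡ-≤ _ (ℕ.*-monoˡ-≤ (lookup u i) (A≤M i)) ⟩
        M * lookup u i + n * (M * M)       <⟨ ℕ.+-monoˡ-< (n * (M * M)) (ℕ.*-monoʳ-< M uᵢ<R) ⟩
        M * R + n * (M * M)                ≡⟨ ℕ.+-comm (M * R) _ ⟩
        N₀                                 ∎
        where open ℕ.≤-Reasoning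

  nonVertex-shift : ∀ {c u} i → NonVertex c u → NonVertex (c + L) (shift i u)
  nonVertex-shift {c} {u} i = conic-map (shift i)
    (λ {v} (Av≡c , v≢u) → trans (·-shift i v) (cong (_+ L) Av≡c) , v≢u ∘ raise-injective i (d i))
    (δ-raise i (d i) u)

  module Unshift {c u i} (Au≡c : A · u ≡ c) (M≤uᵢ : M ≤ lookup u i) (c-large : n * (M * M) ≤ c) where

    largeElsewhere : ∀ v → A · v ≡ c + L → lookup v i < d i → ∃ λ k → k ≢ i × M ≤ lookup v k
    largeElsewhere v Av≡c+L vᵢ<dᵢ with Fin.any? (λ k → ¬? (k Fin.≟ i) ×-dec (M ℕ.≤? lookup v k))
    ... | yes found = found
    ... | no none = ⊥-elim (ℕ.<-irrefl (ℕ.+-comm c L) (ℕ.<-≤-trans c+L<L+nMM (ℕ.+-monoʳ-≤ L c-large)))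
      where
      small : ∀ k → k ≢ i → lookup v k < M
      small k k≢i = ℕ.≰⇒> λ M≤vₖ → none (k , k≢i , M≤vₖ)
      c+L<L+nMM : c + L < L + n * (M * M)
      c+L<L+nMM = begin-strict
        c + L                          ≡⟨ Av≡c+L ⟨
        A · v                          ≤⟨ ·-≤-except v i small ⟩
        A i * lookup v i + n * (M * M)
          <⟨ ℕ.+-monoˡ-< _ (subst (A i * lookup v i <_) (A*d≡L i) (ℕ.*-monoʳ-< (A i) {{A>0 i}} vᵢ<dᵢ)) ⟩
        L + n * (M * M)                ∎
        where open ℕ.≤-Reasoning

    -- each trade records the step exchange A k i u − u and raises coordinate i of v by A k
    decompose : ∀ fuel v → InFibreExcept (c + L) (shift i u) v → d i ≤ lookup v i + fuel →
                Conic (InFibreExcept c u) (δ u) (δ (shift i u) v)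
    decompose fuel v (Av≡c+L , v≢) enough with d i ℕ.≤? lookup v i
    ... | yes dᵢ≤vᵢ = conic-≗ same (conic-single 0<1 (Av′≡c , v′≢u))
      where
      v′ = lower i (d i) v
      shift-v′≡v : shift i v′ ≡ v
      shift-v′≡v = raise-lower i (d i) v dᵢ≤vᵢ
      Av′≡c : A · v′ ≡ c
      Av′≡c = ℕ.+-cancelʳ-≡ L _ _ (trans (sym (·-shift i v′)) (trans (cong (A ·_) shift-v′≡v) Av≡c+L))
      v′≢u : v′ ≢ u
      v′≢u v′≡u = v≢ (trans (sym shift-v′≡v) (cong (shift i) v′≡u))
      same : ∀ l → 1ℚ ℚ.* δ u v′ l ≡ δ (shift i u) v l
      same l = trans (ℚ.*-identityˡ _)
        (trans (sym (δ-raise i (d i) u v′ l)) (cong (λ w → δ (shift i u) w l) shift-v′≡v))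
    decompose zero v _ enough | no dᵢ≰vᵢ = ⊥-elim (dᵢ≰vᵢ (subst (d i ≤_) (ℕ.+-identityʳ _) enough))
    decompose (suc fuel) v (Av≡c+L , v≢) enough | no dᵢ≰vᵢ
      with largeElsewhere v Av≡c+L (ℕ.≰⇒> dᵢ≰vᵢ)
    ... | k , k≢i , M≤vₖ = conic-≗ chain (conic-cons (ℚ.<⇒≤ 0<1) g-in (decompose fuel v″ v″-in enough″))
      where
      Aₖ≤uᵢ = ℕ.≤-trans (A≤M k) M≤uᵢ
      Aᵢ≤vₖ = ℕ.≤-trans (A≤M i) M≤vₖ
      g = exchange A k i u
      v″ = exchange A i k v
      g-in : InFibreExcept c u g
      g-in = trans (·-exchange A k≢i u Aₖ≤uᵢ) Au≡c , exchange-≢ k≢i u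
      v″ᵢ≡ : lookup v″ i ≡ lookup v i + A k
      v″ᵢ≡ = lookup-exchange-raised A (k≢i ∘ sym) v
      v″-in : InFibreExcept (c + L) (shift i u) v″
      v″-in = trans (·-exchange A (k≢i ∘ sym) v Aᵢ≤vₖ) Av≡c+L , λ v″≡ → ℕ.<-irrefl
        (trans (sym v″ᵢ≡) (trans (cong (λ w → lookup w i) v″≡)
                                 (trans (lookup-raise i (d i) u) (ℕ.+-comm (lookup u i) (d i)))))
        (ℕ.+-mono-<-≤ (ℕ.≰⇒> dᵢ≰vᵢ) Aₖ≤uᵢ)
      enough″ : d i ≤ lookup v″ i + fuel
      enough″ = begin
        d i                        ≤⟨ enough ⟩
        lookup v i + suc fuel      ≡⟨ ℕ.+-assoc (lookup v i) 1 fuel ⟨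
        lookup v i + 1 + fuel      ≤⟨ ℕ.+-monoˡ-≤ fuel (ℕ.+-monoʳ-≤ (lookup v i) (0<A k)) ⟩
        lookup v i + A k + fuel    ≡⟨ cong (_+ fuel) v″ᵢ≡ ⟨
        lookup v″ i + fuel         ∎
        where open ℕ.≤-Reasoning
      chain : ∀ l → 1ℚ ℚ.* δ u g l ℚ.+ δ (shift i u) v″ l ≡ δ (shift i u) v l
      chain l = begin
        1ℚ ℚ.* δ u g l ℚ.+ δ (shift i u) v″ l
          ≡⟨ cong (ℚ._+ δ (shift i u) v″ l) (ℚ.*-identityˡ (δ u g l)) ⟩
        δ u g l ℚ.+ δ (shift i u) v″ l
          ≡⟨ cong (ℚ._+ δ (shift i u) v″ l) (δ-translate u g v″ v l
               (trans (exchange-opposite A k≢i u v Aₖ≤uᵢ Aᵢ≤vₖ l) (ℕ.+-comm (lookup u l) (lookup v l)))) ⟩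
        δ v″ v l ℚ.+ δ (shift i u) v″ l       ≡⟨ ℚ.+-comm (δ v″ v l) _ ⟩
        δ (shift i u) v″ l ℚ.+ δ v″ v l       ≡⟨ δ-trans (shift i u) v″ v l ⟩
        δ (shift i u) v l                     ∎
        where open ≡-Reasoning

    nonVertex-unshift : NonVertex (c + L) (shift i u) → NonVertex c u
    nonVertex-unshift = conic-bind λ {v} v-in → decompose (d i) v v-in (ℕ.m≤n+m (d i) (lookup v i))

  φ : Vec ℕ n → Vec ℕ n
  φ = raiseFirstAbove M d

  φ-injective : ∀ {u v} → φ u ≡ φ v → u ≡ v
  φ-injective = raiseFirstAbove-injective M d

  shifted-vertex : ∀ {b u} → N₀ ≤ b → IsVertex A b u → IsVertex A (b + L) (φ u)
  shifted-vertex {b} {u} N₀≤b isVertex with vertex-shape N₀≤b isVertex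
  ... | i , R≤uᵢ , small =
    subst (IsVertex A (b + L)) (sym (raiseFirstAbove-only M d u i M≤uᵢ small))
      (¬nonVertex⇒vertex (trans (·-shift i u) (cong (_+ L) Au≡b))
        (vertex⇒¬nonVertex isVertex ∘ Unshift.nonVertex-unshift Au≡b M≤uᵢ (ℕ.≤-trans (ℕ.m≤m+n _ _) N₀≤b)))
    where
    Au≡b : A · u ≡ b
    Au≡b = proj₁ isVertex
    M≤uᵢ : M ≤ lookup u i
    M≤uᵢ = ℕ.≤-trans (ℕ.m≤n+m M L) R≤uᵢ

  unshifted-vertex : ∀ {b v} → N₀ ≤ b → IsVertex A (b + L) v → ∃ λ u → IsVertex A b u × φ u ≡ v
  unshifted-vertex {b} {v} N₀≤b isVertex with vertex-shape (ℕ.≤-trans N₀≤b (ℕ.m≤m+n b L)) isVertex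
  ... | i , R≤vᵢ , small = u , isVertexᵤ , trans (raiseFirstAbove-only M d u i M≤uᵢ smallᵤ) shift-u≡v
    where
    u = lower i (d i) v
    shift-u≡v : shift i u ≡ v
    shift-u≡v = raise-lower i (d i) v (ℕ.≤-trans (d≤L i) (ℕ.≤-trans (ℕ.m≤m+n L M) R≤vᵢ))
    Au≡b : A · u ≡ b
    Au≡b = ℕ.+-cancelʳ-≡ L _ _ (trans (sym (·-shift i u)) (trans (cong (A ·_) shift-u≡v) (proj₁ isVertex)))
    isVertexᵤ : IsVertex A b u
    isVertexᵤ = ¬nonVertex⇒vertex Au≡b
      (vertex⇒¬nonVertex (subst (IsVertex A (b + L)) (sym shift-u≡v) isVertex) ∘ nonVertex-shift i)
    M≤uᵢ : M ≤ lookup u i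
    M≤uᵢ = subst (M ≤_) (sym (lookup-lower i (d i) v))
      (ℕ.m+n≤o⇒m≤o∸n M (ℕ.≤-trans (ℕ.+-monoʳ-≤ M (d≤L i))
                                   (subst (_≤ lookup v i) (ℕ.+-comm L M) R≤vᵢ)))
    smallᵤ : ∀ j → j ≢ i → lookup u j < M
    smallᵤ j j≢i = subst (_< M) (sym (lookup-lower-≢ (d i) v j≢i)) (small j j≢i)

proposition2p15 : (n : ℕ) (A : Fin n → ℕ) → (∀ i → NonZero (A i)) →
    Σ ℕ λ N → ∀ b → N ≤ b →
      Σ ℕ λ k → VertexCount A b k × VertexCount A (b + lcmAll A) k
proposition2p15 n A A>0 = N₀ , λ b N₀≤b → length (vertices b) , vertices-count b ,
  vertexCount-bijection {A = A} φ φ-injective (shifted-vertex N₀≤b) (unshifted-vertex N₀≤b) (vertices-count b)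
  where
  open Fibres A A>0
  open Periodicity A A>0
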